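{- In any Q-structure, for any facts $F,G,H$: $(F\otimes G)\otimes H=\big(((F\cdot G)\cdot H)^\perp\big)^\perp$.
   Context: A Q-structure is a tuple $\langle\mathcal P,\mathcal Z,\cdot,1\rangle$ with $\mathcal P$ a set, $\mathcal Z\subseteq\mathcal P$, $\cdot$ a binary operation on $\mathcal P$ (not assumed associative or commutative), and $1\in\mathcal P$. These satisfy, for all $x,y,z$: $x\cdot y\in\mathcal Z$ iff $y\cdot x\in\mathcal Z$; $(x\cdot y)\cdot z\in\mathcal Z$ iff $x\cdot(z\cdot y)\in\mathcal Z$; and $1\cdot x=x\cdot1=x$. For $A\subseteq\mathcal P$, $A^\perp=\{b: b\cdot a\in\mathcal Z\ \forall a\in A\}$. A fact is a subset $F$ with $F=(F^\perp)^\perp$. For $A,B\subseteq\mathcal P$, $A\cdot B=\{a\cdot b:a\in A,b\in B\}$. For facts $F,G$, $F\otimes G=((F\cdot G)^\perp)^\perp$. -}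

module Defs where

open import Data.Product using (Σ; _×_; _,_; ∃)
open import Relation.Binary.PropositionalEquality using (_≡_)

record QStructure : Set₁ where
  field
    P     : Set
    Z     : P → Set
    _·_   : P → P → P
    one   : P
    comm-Z  : ∀ x y → (Z (x · y) → Z (y · x)) × (Z (y · x) → Z (x · y))
    assoc-Z : ∀ x y z → (Z ((x · y) · z) → Z (x · (z · y)))
                      × (Z (x · (z · y)) → Z ((x · y) · z))
    unitˡ : ∀ x → one · x ≡ x
    unitʳ : ∀ x → x · one ≡ x

module QS (Q : QStructure) where
  open QStructure Q

  Subset : Set₁
  Subset = P → Set

  _⊆_ : Subset → Subset → Set
  A ⊆ B = ∀ x → A x → B x

  _≐_ : Subset → Subset → Set
  A ≐ B = (A ⊆ B) × (B ⊆ A)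

  _⊥ : Subset → Subset
  (A ⊥) b = ∀ a → A a → Z (b · a)

  _⊙_ : Subset → Subset → Subset
  (A ⊙ B) c = Σ P λ a → Σ P λ b → A a × B b × (c ≡ a · b)

  IsFact : Subset → Set
  IsFact F = F ≐ ((F ⊥) ⊥)

  _⊗_ : Subset → Subset → Subset
  F ⊗ G = ((F ⊙ G) ⊥) ⊥

-- The orthogonal of a product is computed factorwise: b ∈ (X · H)^⊥ iff
-- b · h ∈ X^⊥ for every h ∈ H, by the two Q-structure axioms.  Since
-- X^⊥ = X^⊥⊥⊥, replacing X by its closure X^⊥⊥ leaves (X · H)^⊥ unchanged;
-- with X = F · G this identifies both sides.  The argument works for
-- arbitrary subsets F, G, H.
module Submission where

open import Defs
open import Data.Product using (_,_; proj₁; proj₂)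
open import Relation.Binary.PropositionalEquality using (refl)

module QStructureProperties (Q : QStructure) where
  open QStructure Q
  open QS Q

  ⊥-antitone : ∀ {A B} → A ⊆ B → (B ⊥) ⊆ (A ⊥)
  ⊥-antitone A⊆B b b∈B⊥ a a∈A = b∈B⊥ a (A⊆B a a∈A)

  ⊥-cong : ∀ {A B} → A ≐ B → (A ⊥) ≐ (B ⊥)
  ⊥-cong (A⊆B , B⊆A) = ⊥-antitone B⊆A , ⊥-antitone A⊆B

  ⊆-⊥⊥ : ∀ A → A ⊆ ((A ⊥) ⊥)
  ⊆-⊥⊥ A a a∈A b b∈A⊥ = proj₁ (comm-Z b a) (b∈A⊥ a a∈A)

  ⊥-⊙⇒⊥ : ∀ X H b → ((X ⊙ H) ⊥) b → ∀ h → H h → (X ⊥) (b · h)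
  ⊥-⊙⇒⊥ X H b b∈XH⊥ h h∈H x x∈X =
    proj₂ (assoc-Z b h x) (b∈XH⊥ (x · h) (x , h , x∈X , h∈H , refl))

  ⊥⇒⊥-⊙ : ∀ X H b → (∀ h → H h → (X ⊥) (b · h)) → ((X ⊙ H) ⊥) b
  ⊥⇒⊥-⊙ X H b bH⊆X⊥ _ (x , h , x∈X , h∈H , refl) =
    proj₁ (assoc-Z b h x) (bH⊆X⊥ h h∈H x x∈X)

  ⊙-monoˡ : ∀ {A B} H → A ⊆ B → (A ⊙ H) ⊆ (B ⊙ H)
  ⊙-monoˡ H A⊆B _ (a , h , a∈A , h∈H , c≡ah) = a , h , A⊆B a a∈A , h∈H , c≡ah

  ⊥-⊙-closureˡ : ∀ X H → ((((X ⊥) ⊥) ⊙ H) ⊥) ≐ ((X ⊙ H) ⊥)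
  ⊥-⊙-closureˡ X H =
    ⊥-antitone (⊙-monoˡ H (⊆-⊥⊥ X)) ,
    λ b b∈XH⊥ → ⊥⇒⊥-⊙ ((X ⊥) ⊥) H b λ h h∈H →
      ⊆-⊥⊥ (X ⊥) (b · h) (⊥-⊙⇒⊥ X H b b∈XH⊥ h h∈H)

lemma8 : (Q : QStructure) → let open QS Q in
           (F G H : Subset) → IsFact F → IsFact G → IsFact H →
             ((F ⊗ G) ⊗ H) ≐ ((((F ⊙ G) ⊙ H) ⊥) ⊥)
lemma8 Q F G H _ _ _ = ⊥-cong (⊥-⊙-closureˡ (F ⊙ G) H)
  where open QS Q
        open QStructureProperties Q
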